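{- Let $\mathcal{S}=(a_{n,m})_{n,m\geq 0}$ be the infinite matrix of complex numbers determined by an initial column $(a_{n,0})_{n\geq0}$ via $a_{n,m+1}=a_{n+1,m}-m\,a_{n,m}$ for all $n,m\geq 0$. Fix $r\geq 0$ and let $\mathcal{B}_r(z)=\sum_{k\geq 0}a_{k+r,0}\frac{z^k}{k!}$ and $\mathcal{A}_r(z)=\sum_{m\geq 0}a_{r,m}\frac{z^m}{m!}$ (formal power series). Then $$\mathcal{A}_r(z)=\mathcal{B}_r\left(\ln(1+z)\right).$$ -}

module Defs where

open import Level using (Level)
open import Data.Nat using (ℕ; zero; suc; _∸_)
open import Algebra.Bundles using (CommutativeRing)

-- Formal power series over a commutative ring R, represented by their
-- coefficient sequences ℕ → Carrier (equality: pointwise ≈).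
module PS {c ℓ : Level} (R : CommutativeRing c ℓ) where
  open CommutativeRing R

  Series : Set c
  Series = ℕ → Carrier

  ι : ℕ → Carrier
  ι zero    = 0#
  ι (suc n) = 1# + ι n

  sumTo : ℕ → (ℕ → Carrier) → Carrier
  sumTo zero    f = 0#
  sumTo (suc n) f = sumTo n f + f n

  _⋆_ : Series → Series → Series
  (f ⋆ g) n = sumTo (suc n) (λ i → f i * g (n ∸ i))

  oneS : Series
  oneS zero    = 1#
  oneS (suc _) = 0#

  powS : Series → ℕ → Series
  powS g zero    = oneS
  powS g (suc k) = g ⋆ powS g k

  -- composition b(g(z)) for g with zero constant term:
  -- the n-th coefficient only involves g^k for k ≤ n.
  compose : Series → Series → Series
  compose b g n = sumTo (suc n) (λ k → b k * powS g k n)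

  -- In what follows  inv k  is the inverse of (k+1) in R.
  module WithInverses (inv : ℕ → Carrier) where

    invFact : ℕ → Carrier
    invFact zero    = 1#
    invFact (suc m) = invFact m * inv m

    sign : ℕ → Carrier
    sign zero    = 1#
    sign (suc n) = - sign n

    log1p : Series
    log1p zero    = 0#
    log1p (suc n) = sign n * inv n

    mat : (ℕ → Carrier) → ℕ → ℕ → Carrier
    mat a0 n zero    = a0 n
    mat a0 n (suc m) = mat a0 (suc n) m - ι m * mat a0 n m

    B : (ℕ → Carrier) → ℕ → Series
    B a0 r k = mat a0 (k Data.Nat.+ r) 0 * invFact k

    A : (ℕ → Carrier) → ℕ → Series
    A a0 r m = mat a0 r m * invFact m

-- Write δ = (1 + z) d/dz, so that (δ F)_m = (m+1) F_{m+1} + m F_m.  Both families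
-- F_r = A_r and F_r = B_r(log(1+z)) solve the differential recurrence δ F_r = F_{r+1}:
-- for A_r this is the defining recursion a_{n,m+1} + m a_{n,m} = a_{n+1,m} read
-- coefficientwise, and for B_r(log(1+z)) it follows from the chain rule
-- δ(L^k) = k L^(k-1) for L = log(1+z), itself a consequence of δ L = 1 and the
-- Leibniz rule.  Once 1, 2, 3, … are invertible, the coefficient of z^(m+1) in F_r is
-- determined by δ F_r = F_{r+1} and the lower coefficients, so the two families
-- agree as soon as their constant terms a_{r,0} do.
module Submission where

open import Defs
open import Data.Nat using (ℕ; zero; suc; _∸_; _<_; _≤_; s≤s) renaming (_+_ to _+ℕ_)
open import Data.Nat.Properties using (m<n⇒m<1+n; n<1+n; m+[n∸m]≡n; +-∸-assoc; n∸n≡0; m∸n≤m; ≤-<-trans; +-suc)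
open import Algebra.Bundles using (CommutativeRing)
import Relation.Binary.PropositionalEquality as ≡

module FormalSeries {c ℓ} (R : CommutativeRing c ℓ) where
  open CommutativeRing R
  open PS R
  open import Relation.Binary.Reasoning.Setoid setoid
  open import Algebra.Properties.CommutativeSemigroup +-commutativeSemigroup
    using () renaming (interchange to +-interchange)
  open import Algebra.Properties.CommutativeSemigroup *-commutativeSemigroup
    using () renaming (x∙yz≈y∙xz to x*[y*z]≈y*[x*z]; x∙yz≈yx∙z to x*[y*z]≈[y*x]*z)
  open import Algebra.Properties.Group +-group using (//-rightDividesˡ; //-rightDividesʳ)

  infix 4 _≋_
  infixl 6 _+ₛ_
  infixr 7 _·ₛ_

  _≋_ : Series → Series → Set ℓ
  f ≋ g = ∀ n → f n ≈ g n

  _+ₛ_ : Series → Series → Series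
  (f +ₛ g) n = f n + g n

  _·ₛ_ : Carrier → Series → Series
  (a ·ₛ f) n = a * f n

  ι-+ : ∀ m n → ι (m +ℕ n) ≈ ι m + ι n
  ι-+ zero    n = sym (+-identityˡ (ι n))
  ι-+ (suc m) n = trans (+-congˡ (ι-+ m n)) (sym (+-assoc 1# (ι m) (ι n)))

  ι-∸ : ∀ {i n} → i ≤ n → ι i + ι (n ∸ i) ≈ ι n
  ι-∸ {i} {n} i≤n = trans (sym (ι-+ i (n ∸ i))) (reflexive (≡.cong ι (m+[n∸m]≡n i≤n)))

  sumTo-cong : ∀ n {f g : ℕ → Carrier} → (∀ i → i < n → f i ≈ g i) → sumTo n f ≈ sumTo n g
  sumTo-cong zero    f≈g = refl
  sumTo-cong (suc n) f≈g = +-cong (sumTo-cong n (λ i i<n → f≈g i (m<n⇒m<1+n i<n))) (f≈g n (n<1+n n))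

  sumTo-congʷ : ∀ n {f g : ℕ → Carrier} → (∀ i → f i ≈ g i) → sumTo n f ≈ sumTo n g
  sumTo-congʷ n f≈g = sumTo-cong n (λ i _ → f≈g i)

  sumTo-zero : ∀ n (f : ℕ → Carrier) → (∀ i → i < n → f i ≈ 0#) → sumTo n f ≈ 0#
  sumTo-zero n f f≈0 = trans (sumTo-cong n f≈0) (sumTo-0 n)
    where
    sumTo-0 : ∀ n → sumTo n (λ _ → 0#) ≈ 0#
    sumTo-0 zero    = refl
    sumTo-0 (suc n) = trans (+-identityʳ _) (sumTo-0 n)

  sumTo-head : ∀ n f → sumTo (suc n) f ≈ f 0 + sumTo n (λ i → f (suc i))
  sumTo-head zero    f = +-comm 0# (f 0)
  sumTo-head (suc n) f = trans (+-congʳ (sumTo-head n f)) (+-assoc _ _ _)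

  sumTo-+ : ∀ n f g → sumTo n (λ i → f i + g i) ≈ sumTo n f + sumTo n g
  sumTo-+ zero    f g = sym (+-identityˡ 0#)
  sumTo-+ (suc n) f g = trans (+-congʳ (sumTo-+ n f g)) (+-interchange _ _ _ _)

  *-distribˡ-sumTo : ∀ n a f → a * sumTo n f ≈ sumTo n (λ i → a * f i)
  *-distribˡ-sumTo zero    a f = zeroʳ a
  *-distribˡ-sumTo (suc n) a f = trans (distribˡ a _ _) (+-congʳ (*-distribˡ-sumTo n a f))

  ⋆-congˡ : ∀ {f g} h → f ≋ g → f ⋆ h ≋ g ⋆ h
  ⋆-congˡ h f≋g n = sumTo-congʷ (suc n) (λ i → *-congʳ (f≋g i))

  ⋆-congʳ : ∀ f {g h} → g ≋ h → f ⋆ g ≋ f ⋆ h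
  ⋆-congʳ f g≋h n = sumTo-congʷ (suc n) (λ i → *-congˡ (g≋h (n ∸ i)))

  ⋆-distribˡ : ∀ f g h → f ⋆ (g +ₛ h) ≋ f ⋆ g +ₛ f ⋆ h
  ⋆-distribˡ f g h n = trans (sumTo-congʷ (suc n) (λ i → distribˡ (f i) _ _)) (sumTo-+ (suc n) _ _)

  ⋆-distribʳ : ∀ f g h → (g +ₛ h) ⋆ f ≋ g ⋆ f +ₛ h ⋆ f
  ⋆-distribʳ f g h n = trans (sumTo-congʷ (suc n) (λ i → distribʳ (f (n ∸ i)) _ _)) (sumTo-+ (suc n) _ _)

  ⋆-homoʳ : ∀ f g a → f ⋆ (a ·ₛ g) ≋ a ·ₛ (f ⋆ g)
  ⋆-homoʳ f g a n = sym (trans (*-distribˡ-sumTo (suc n) a _)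
                               (sumTo-congʷ (suc n) (λ i → x*[y*z]≈y*[x*z] a (f i) (g (n ∸ i)))))

  ⋆-zeroʳ : ∀ f {g} → g ≋ (λ _ → 0#) → f ⋆ g ≋ (λ _ → 0#)
  ⋆-zeroʳ f g≋0 n = sumTo-zero (suc n) _ (λ i _ → trans (*-congˡ (g≋0 (n ∸ i))) (zeroʳ (f i)))

  ⋆-identityˡ : ∀ f → oneS ⋆ f ≋ f
  ⋆-identityˡ f n = begin
    (oneS ⋆ f) n                                   ≈⟨ sumTo-head n _ ⟩
    1# * f n + sumTo n (λ i → 0# * f (n ∸ suc i))  ≈⟨ +-cong (*-identityˡ (f n)) (sumTo-zero n _ (λ i _ → zeroˡ _)) ⟩
    f n + 0#                                       ≈⟨ +-identityʳ (f n) ⟩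
    f n                                            ∎

  powS-vanishes : ∀ g → g 0 ≈ 0# → ∀ k n → n < k → powS g k n ≈ 0#
  powS-vanishes g g₀≈0 (suc k) zero    _           = trans (+-identityˡ _) (trans (*-congʳ g₀≈0) (zeroˡ _))
  powS-vanishes g g₀≈0 (suc k) (suc n) (s≤s 1+n≤k) = begin
    (g ⋆ powS g k) (suc n)                                       ≈⟨ sumTo-head (suc n) _ ⟩
    g 0 * powS g k (suc n) + sumTo (suc n) (λ i → g (suc i) * powS g k (n ∸ i))
      ≈⟨ +-cong (trans (*-congʳ g₀≈0) (zeroˡ _)) (sumTo-zero (suc n) _ vanishing-terms) ⟩
    0# + 0#                                                      ≈⟨ +-identityʳ 0# ⟩
    0#                                                           ∎
    where
    vanishing-terms : ∀ i → i < suc n → g (suc i) * powS g k (n ∸ i) ≈ 0#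
    vanishing-terms i _ =
      trans (*-congˡ (powS-vanishes g g₀≈0 k (n ∸ i) (≤-<-trans (m∸n≤m n i) 1+n≤k))) (zeroʳ _)

  -- θ = z d/dz, and deriv = d/dz since (n+1) f_{n+1} = θ f (n+1).
  θ : Series → Series
  θ f n = ι n * f n

  deriv : Series → Series
  deriv f n = θ f (suc n)

  δ : Series → Series
  δ f = deriv f +ₛ θ f

  θ-Leibniz : ∀ f g → θ (f ⋆ g) ≋ θ f ⋆ g +ₛ f ⋆ θ g
  θ-Leibniz f g n = begin
    ι n * sumTo (suc n) F                                            ≈⟨ *-distribˡ-sumTo (suc n) (ι n) F ⟩
    sumTo (suc n) (λ i → ι n * F i)                                  ≈⟨ sumTo-cong (suc n) split ⟩
    sumTo (suc n) (λ i → ι i * F i + ι (n ∸ i) * F i)                ≈⟨ sumTo-+ (suc n) _ _ ⟩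
    sumTo (suc n) (λ i → ι i * F i) + sumTo (suc n) (λ i → ι (n ∸ i) * F i)
      ≈⟨ sym (+-cong (sumTo-congʷ (suc n) (λ i → *-assoc _ _ _))
                     (sumTo-congʷ (suc n) (λ i → x*[y*z]≈y*[x*z] (f i) _ _))) ⟩
    (θ f ⋆ g) n + (f ⋆ θ g) n                                        ∎
    where
    F : ℕ → Carrier
    F i = f i * g (n ∸ i)
    split : ∀ i → i < suc n → ι n * F i ≈ ι i * F i + ι (n ∸ i) * F i
    split i (s≤s i≤n) = trans (*-congʳ (sym (ι-∸ i≤n))) (distribʳ (F i) _ _)

  θ-⋆-suc : ∀ f g n → (θ f ⋆ g) (suc n) ≈ (deriv f ⋆ g) n
  θ-⋆-suc f g n = begin
    (θ f ⋆ g) (suc n)                         ≈⟨ sumTo-head (suc n) _ ⟩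
    (0# * f 0) * g (suc n) + (deriv f ⋆ g) n  ≈⟨ +-congʳ (trans (*-congʳ (zeroˡ (f 0))) (zeroˡ _)) ⟩
    0# + (deriv f ⋆ g) n                      ≈⟨ +-identityˡ _ ⟩
    (deriv f ⋆ g) n                           ∎

  ⋆-θ-suc : ∀ f g n → (f ⋆ θ g) (suc n) ≈ (f ⋆ deriv g) n
  ⋆-θ-suc f g n = trans (+-cong (sumTo-cong (suc n) lower) top) (+-identityʳ _)
    where
    lower : ∀ i → i < suc n → f i * θ g (suc n ∸ i) ≈ f i * deriv g (n ∸ i)
    lower i (s≤s i≤n) = reflexive (≡.cong (λ j → f i * θ g j) (+-∸-assoc 1 i≤n))
    top : f (suc n) * θ g (n ∸ n) ≈ 0#
    top = trans (reflexive (≡.cong (λ j → f (suc n) * θ g j) (n∸n≡0 n)))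
                (trans (*-congˡ (zeroˡ (g 0))) (zeroʳ _))

  deriv-Leibniz : ∀ f g → deriv (f ⋆ g) ≋ deriv f ⋆ g +ₛ f ⋆ deriv g
  deriv-Leibniz f g n = trans (θ-Leibniz f g (suc n)) (+-cong (θ-⋆-suc f g n) (⋆-θ-suc f g n))

  δ-Leibniz : ∀ f g → δ (f ⋆ g) ≋ δ f ⋆ g +ₛ f ⋆ δ g
  δ-Leibniz f g n = begin
    deriv (f ⋆ g) n + θ (f ⋆ g) n
      ≈⟨ +-cong (deriv-Leibniz f g n) (θ-Leibniz f g n) ⟩
    ((deriv f ⋆ g) n + (f ⋆ deriv g) n) + ((θ f ⋆ g) n + (f ⋆ θ g) n)
      ≈⟨ +-interchange _ _ _ _ ⟩
    ((deriv f ⋆ g) n + (θ f ⋆ g) n) + ((f ⋆ deriv g) n + (f ⋆ θ g) n)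
      ≈⟨ sym (+-cong (⋆-distribʳ g (deriv f) (θ f) n) (⋆-distribˡ f (deriv g) (θ g) n)) ⟩
    (δ f ⋆ g) n + (f ⋆ δ g) n ∎

  δ-+ : ∀ f g → δ (f +ₛ g) ≋ δ f +ₛ δ g
  δ-+ f g n = trans (+-cong (distribˡ (ι (suc n)) _ _) (distribˡ (ι n) _ _)) (+-interchange _ _ _ _)

  δ-· : ∀ a f → δ (a ·ₛ f) ≋ a ·ₛ δ f
  δ-· a f n = trans (+-cong (x*[y*z]≈y*[x*z] _ a _) (x*[y*z]≈y*[x*z] _ a _)) (sym (distribˡ a _ _))

  δ-sumTo : ∀ N (b : ℕ → Carrier) (F : ℕ → Series) →
            δ (λ j → sumTo N (λ k → b k * F k j)) ≋ (λ n → sumTo N (λ k → b k * δ (F k) n))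
  δ-sumTo zero    b F n = trans (+-cong (zeroʳ _) (zeroʳ _)) (+-identityʳ 0#)
  δ-sumTo (suc N) b F n = trans (δ-+ (λ j → sumTo N (λ k → b k * F k j)) (b N ·ₛ F N) n)
                                (+-cong (δ-sumTo N b F n) (δ-· (b N) (F N) n))

  δ-oneS : δ oneS ≋ (λ _ → 0#)
  δ-oneS zero    = trans (+-cong (zeroʳ _) (zeroˡ _)) (+-identityʳ 0#)
  δ-oneS (suc n) = trans (+-cong (zeroʳ _) (zeroʳ _)) (+-identityʳ 0#)

  compose-cong : ∀ {b b′} g → b ≋ b′ → compose b g ≋ compose b′ g
  compose-cong g b≋b′ n = sumTo-congʷ (suc n) (λ k → *-congʳ (b≋b′ k))

  module ChainRule (g : Series) (g₀≈0 : g 0 ≈ 0#) (δg≋1 : δ g ≋ oneS) where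

    δ-powS : ∀ k → δ (powS g (suc k)) ≋ ι (suc k) ·ₛ powS g k
    δ-powS k n = begin
      δ (g ⋆ powS g k) n                                 ≈⟨ δ-Leibniz g (powS g k) n ⟩
      (δ g ⋆ powS g k) n + (g ⋆ δ (powS g k)) n
        ≈⟨ +-cong (trans (⋆-congˡ (powS g k) δg≋1 n) (⋆-identityˡ (powS g k) n)) (g⋆δpowS k) ⟩
      powS g k n + ι k * powS g k n                      ≈⟨ +-congʳ (sym (*-identityˡ _)) ⟩
      1# * powS g k n + ι k * powS g k n                 ≈⟨ sym (distribʳ _ 1# (ι k)) ⟩
      ι (suc k) * powS g k n                             ∎
      where
      g⋆δpowS : ∀ k → (g ⋆ δ (powS g k)) n ≈ ι k * powS g k n
      g⋆δpowS zero    = trans (⋆-zeroʳ g δ-oneS n) (sym (zeroˡ _))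
      g⋆δpowS (suc k) = trans (⋆-congʳ g (δ-powS k) n) (⋆-homoʳ g (powS g k) (ι (suc k)) n)

    δ-compose : ∀ b → δ (compose b g) ≋ compose (deriv b) g
    δ-compose b n = begin
      -- compose b g (suc n) already has suc (suc n) terms; the extra term at n vanishes
      -- because g^(n+1) starts at z^(n+1).
      δ (compose b g) n
        ≈⟨ +-congˡ (*-congˡ one-more-term) ⟩
      δ (λ j → sumTo (suc (suc n)) (λ k → b k * powS g k j)) n
        ≈⟨ δ-sumTo (suc (suc n)) b (powS g) n ⟩
      sumTo (suc (suc n)) (λ k → b k * δ (powS g k) n)
        ≈⟨ sumTo-head (suc n) _ ⟩
      b 0 * δ oneS n + sumTo (suc n) (λ k → b (suc k) * δ (powS g (suc k)) n)
        ≈⟨ +-cong (trans (*-congˡ (δ-oneS n)) (zeroʳ _)) (sumTo-congʷ (suc n) (λ k → *-congˡ (δ-powS k n))) ⟩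
      0# + sumTo (suc n) (λ k → b (suc k) * (ι (suc k) * powS g k n))
        ≈⟨ +-identityˡ _ ⟩
      sumTo (suc n) (λ k → b (suc k) * (ι (suc k) * powS g k n))
        ≈⟨ sumTo-congʷ (suc n) (λ k → x*[y*z]≈[y*x]*z _ _ _) ⟩
      compose (deriv b) g n
        ∎
      where
      one-more-term : compose b g n ≈ sumTo (suc (suc n)) (λ k → b k * powS g k n)
      one-more-term = sym (trans (+-congˡ (trans (*-congˡ (powS-vanishes g g₀≈0 (suc n) n (n<1+n n))) (zeroʳ _)))
                                 (+-identityʳ _))

  module Inverses (inv : ℕ → Carrier) (ι*inv≈1 : ∀ n → ι (suc n) * inv n ≈ 1#) where
    open WithInverses inv

    ι-*-inv : ∀ n x → ι (suc n) * (x * inv n) ≈ x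
    ι-*-inv n x = trans (x*[y*z]≈y*[x*z] _ x _) (trans (*-congˡ (ι*inv≈1 n)) (*-identityʳ x))

    inv-*-ι : ∀ n x → inv n * (ι (suc n) * x) ≈ x
    inv-*-ι n x = trans (sym (*-assoc _ _ x)) (trans (*-congʳ (trans (*-comm _ _) (ι*inv≈1 n))) (*-identityˡ x))

    δ-log1p : δ log1p ≋ oneS
    δ-log1p zero    = trans (+-cong (ι-*-inv 0 1#) (zeroˡ 0#)) (+-identityʳ 1#)
    δ-log1p (suc n) = trans (+-cong (ι-*-inv (suc n) _) (ι-*-inv n _)) (-‿inverseˡ (sign n))

    coefficient-from-δ : ∀ f m → f (suc m) ≈ inv m * (δ f m - ι m * f m)
    coefficient-from-δ f m = trans (sym (inv-*-ι m _)) (*-congˡ (sym (//-rightDividesʳ (ι m * f m) _)))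

    solutions-unique : ∀ (F G : ℕ → Series) → (∀ r → δ (F r) ≋ F (suc r)) → (∀ r → δ (G r) ≋ G (suc r)) →
                       (∀ r → F r 0 ≈ G r 0) → ∀ r → F r ≋ G r
    solutions-unique F G δF δG F₀≈G₀ r zero    = F₀≈G₀ r
    solutions-unique F G δF δG F₀≈G₀ r (suc m) = begin
      F r (suc m)                            ≈⟨ coefficient-from-δ (F r) m ⟩
      inv m * (δ (F r) m - ι m * F r m)      ≈⟨ *-congˡ (+-cong δF≈δG (-‿cong (*-congˡ (F≋G r m)))) ⟩
      inv m * (δ (G r) m - ι m * G r m)      ≈⟨ sym (coefficient-from-δ (G r) m) ⟩
      G r (suc m)                            ∎
      where
      F≋G : ∀ r → F r ≋ G r
      F≋G = solutions-unique F G δF δG F₀≈G₀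
      δF≈δG : δ (F r) m ≈ δ (G r) m
      δF≈δG = trans (δF r m) (trans (F≋G (suc r) m) (sym (δG r m)))

    δ-A : ∀ a0 r → δ (A a0 r) ≋ A a0 (suc r)
    δ-A a0 r m = begin
      ι (suc m) * (mat a0 r (suc m) * (invFact m * inv m)) + ι m * (mat a0 r m * invFact m)
        ≈⟨ +-cong (trans (*-congˡ (sym (*-assoc _ _ _))) (ι-*-inv m _)) (sym (*-assoc _ _ _)) ⟩
      mat a0 r (suc m) * invFact m + (ι m * mat a0 r m) * invFact m
        ≈⟨ sym (distribʳ _ _ _) ⟩
      (mat a0 r (suc m) + ι m * mat a0 r m) * invFact m
        ≈⟨ *-congʳ (//-rightDividesˡ (ι m * mat a0 r m) (mat a0 (suc r) m)) ⟩
      mat a0 (suc r) m * invFact m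
        ∎

    deriv-B : ∀ a0 r → deriv (B a0 r) ≋ B a0 (suc r)
    deriv-B a0 r k = begin
      ι (suc k) * (a0 (suc k +ℕ r) * (invFact k * inv k))  ≈⟨ *-congˡ (sym (*-assoc _ _ _)) ⟩
      ι (suc k) * ((a0 (suc k +ℕ r) * invFact k) * inv k)  ≈⟨ ι-*-inv k _ ⟩
      a0 (suc k +ℕ r) * invFact k                          ≡⟨ ≡.cong (λ n → a0 n * invFact k) (+-suc k r) ⟨
      a0 (k +ℕ suc r) * invFact k                          ∎

    δ-compose-B-log1p : ∀ a0 r → δ (compose (B a0 r) log1p) ≋ compose (B a0 (suc r)) log1p
    δ-compose-B-log1p a0 r n =
      trans (ChainRule.δ-compose log1p refl δ-log1p (B a0 r) n) (compose-cong log1p (deriv-B a0 r) n)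

theorem4 : ∀ {c ℓ} (R : CommutativeRing c ℓ) (inv : ℕ → CommutativeRing.Carrier R) →
           (∀ n → CommutativeRing._≈_ R (CommutativeRing._*_ R (PS.ι R (suc n)) (inv n)) (CommutativeRing.1# R)) →
           (a0 : ℕ → CommutativeRing.Carrier R) (r : ℕ) (m : ℕ) →
           CommutativeRing._≈_ R (PS.WithInverses.A R inv a0 r m)
             (PS.compose R (PS.WithInverses.B R inv a0 r) (PS.WithInverses.log1p R inv) m)
theorem4 R inv ι*inv≈1 a0 r m =
  solutions-unique (A a0) (λ r → compose (B a0 r) log1p) (δ-A a0) (δ-compose-B-log1p a0) constant-terms r m
  where
  open CommutativeRing R
  open PS R
  open WithInverses inv
  open FormalSeries R
  open Inverses inv ι*inv≈1
  constant-terms : ∀ r → A a0 r 0 ≈ compose (B a0 r) log1p 0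
  constant-terms r = sym (trans (+-identityˡ _) (*-identityʳ _))
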